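{- Let $P$ be a finite poset whose longest chains have length $r$. The following are equivalent: (1) $\mathbb{E}(\mathrm{chain}(k);\mathrm{ddeg})=\mathbb{E}(\mathrm{uni};\mathrm{ddeg})$ for all $k=0,1,\dots,r$; (2) $\mathbb{E}(\mathrm{mchain}(m);\mathrm{ddeg})=\mathbb{E}(\mathrm{uni};\mathrm{ddeg})$ for all $m\ge0$; (3) $\mathbb{E}(\mathrm{mchain}(m);\mathrm{ddeg})=\mathbb{E}(\mathrm{uni};\mathrm{ddeg})$ for all $m=0,1,\dots,r$; (4) $\mathbb{E}(\widehat{\mathrm{mchain}}(m);\mathrm{ddeg})=\mathbb{E}(\mathrm{uni};\mathrm{ddeg})$ for all $m\ge0$; (5) $\mathbb{E}(\widehat{\mathrm{mchain}}(m);\mathrm{ddeg})=\mathbb{E}(\mathrm{uni};\mathrm{ddeg})$ for all $m=0,1,\dots,r$.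
   Context: $\mathrm{ddeg}(p)$ is the number of elements covered by $p$; $\mathrm{uni}$ is the uniform distribution; $\mathbb{E}(\mu;f)=\sum_p f(p)\mu(p)$. A $k$-chain is $c_0<\dots<c_k$; an $m$-multichain is $c_0\le c_1\le\dots\le c_m$; $p\in c$ means $p=c_i$ for some $i$. Distributions on $P$: $\mathbb{P}(\mathrm{chain}(k);p)=\#\{k\text{ -chains } c: p\in c\}/((k+1)\#\{k\text{ -chains}\})$ for $0\le k\le r$; $\mathbb{P}(\mathrm{mchain}(m);p)=\#\{m\text{ -multichains } c: p\in c\}/\#\{(c,q): c \text{ an } m\text{ -multichain}, q\in c\}$; $\mathbb{P}(\widehat{\mathrm{mchain}}(m);p)=\#\{(c,i): c\text{ an } m\text{ -multichain}, c_i=p\}/((m+1)\#\{m\text{ -multichains}\})$. -}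

module Defs where

open import Data.Nat as ℕ using (ℕ; zero; suc)
open import Data.Fin using (Fin)
open import Data.Fin.Properties using (any?)
open import Data.Vec using (Vec; []; _∷_; lookup)
open import Data.Vec.Membership.Propositional using (_∈_)
open import Data.Vec.Membership.DecPropositional as VMem using ()
import Data.Fin.Properties as FinP
open import Data.List using (List; []; _∷_; map; concatMap; allFin; filter; length; foldr)
open import Data.Integer using (+_)
open import Data.Rational as ℚ using (ℚ; 0ℚ; _+_; _*_)
open import Data.Product using (_×_; _,_; Σ; ∃)
open import Data.Unit using (⊤; tt)
open import Relation.Binary.PropositionalEquality using (_≡_; _≢_)
open import Relation.Binary.Structures using (IsPartialOrder)
open import Relation.Binary.Definitions using (Decidable)
open import Relation.Nullary using (¬_; Dec; yes; no)
open import Relation.Nullary.Decidable using (_×-dec_; ¬?)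

record FinitePoset : Set₁ where
  field
    size : ℕ
    _≼_ : Fin size → Fin size → Set
    isPartialOrder : IsPartialOrder _≡_ _≼_
    _≼?_ : Decidable _≼_

module _ (P : FinitePoset) where
  open FinitePoset P

  El : Set
  El = Fin size

  _≺_ : El → El → Set
  x ≺ y = (x ≼ y) × (x ≢ y)

  _≺?_ : Decidable _≺_
  x ≺? y = (x ≼? y) ×-dec ¬? (x FinP.≟ y)

  _⋖_ : El → El → Set
  q ⋖ p = (q ≺ p) × ¬ (∃ λ z → (q ≺ z) × (z ≺ p))

  _⋖?_ : Decidable _⋖_
  q ⋖? p = (q ≺? p) ×-dec ¬? (any? (λ z → (q ≺? z) ×-dec (z ≺? p)))

  ddeg : El → ℕ
  ddeg p = length (filter (_⋖? p) (allFin size))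

  IsChain : ∀ {k} → Vec El k → Set
  IsChain [] = ⊤
  IsChain (x ∷ []) = ⊤
  IsChain (x ∷ y ∷ c) = (x ≺ y) × IsChain (y ∷ c)

  isChain? : ∀ {k} (c : Vec El k) → Dec (IsChain c)
  isChain? [] = yes tt
  isChain? (x ∷ []) = yes tt
  isChain? (x ∷ y ∷ c) = (x ≺? y) ×-dec isChain? (y ∷ c)

  IsMultichain : ∀ {k} → Vec El k → Set
  IsMultichain [] = ⊤
  IsMultichain (x ∷ []) = ⊤
  IsMultichain (x ∷ y ∷ c) = (x ≼ y) × IsMultichain (y ∷ c)

  isMultichain? : ∀ {k} (c : Vec El k) → Dec (IsMultichain c)
  isMultichain? [] = yes tt
  isMultichain? (x ∷ []) = yes tt
  isMultichain? (x ∷ y ∷ c) = (x ≼? y) ×-dec isMultichain? (y ∷ c)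

  allVecs : (k : ℕ) → List (Vec El k)
  allVecs zero = [] ∷ []
  allVecs (suc k) = concatMap (λ x → map (x ∷_) (allVecs k)) (allFin size)

  -- k-chains c₀ < ... < c_k  (vectors of length k+1)
  kChains : (k : ℕ) → List (Vec El (suc k))
  kChains k = filter isChain? (allVecs (suc k))

  mChains : (m : ℕ) → List (Vec El (suc m))
  mChains m = filter isMultichain? (allVecs (suc m))

  _∈?_ : ∀ {k} (p : El) (c : Vec El k) → Dec (p ∈ c)
  p ∈? c = VMem._∈?_ FinP._≟_ p c

  LongestChainLength : ℕ → Set
  LongestChainLength r =
    (Σ (Vec El (suc r)) IsChain) ×
    (∀ k (c : Vec El (suc k)) → IsChain c → k ℕ.≤ r)

  -- a / b as a rational, with the (never used here) convention a / 0 = 0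
  frac : ℕ → ℕ → ℚ
  frac a zero = 0ℚ
  frac a (suc d) = (+ a) ℚ./ suc d

  sumℚ : List ℚ → ℚ
  sumℚ = foldr _+_ 0ℚ

  sumℕ : List ℕ → ℕ
  sumℕ = foldr ℕ._+_ 0

  𝔼 : (El → ℚ) → (El → ℕ) → ℚ
  𝔼 μ f = sumℚ (map (λ p → frac (f p) 1 * μ p) (allFin size))

  uni : El → ℚ
  uni p = frac 1 size

  chainDist : ℕ → El → ℚ
  chainDist k p =
    frac (length (filter (p ∈?_) (kChains k)))
         (suc k ℕ.* length (kChains k))

  mcContaining : ℕ → El → ℕ
  mcContaining m q = length (filter (q ∈?_) (mChains m))

  mchainDist : ℕ → El → ℚ
  mchainDist m p =
    frac (mcContaining m p) (sumℕ (map (mcContaining m) (allFin size)))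

  occurrences : ∀ {k} → El → Vec El k → ℕ
  occurrences {k} p c = length (filter (λ i → lookup c i FinP.≟ p) (allFin k))

  mchainHatDist : ℕ → El → ℚ
  mchainHatDist m p =
    frac (sumℕ (map (occurrences p) (mChains m)))
         (suc m ℕ.* length (mChains m))

-- Each condition compares a ratio of two weighted sums with the uniform average D / n of ddeg
-- (D = Σ ddeg, n = |P|).  Let W_k(g) be the sum, over all k-chains, of the g-weights of their
-- elements.  Cross-multiplying, condition (1) at k says a_k = b_k with a_k = W_k(ddeg) n and
-- b_k = D W_k(1).  An m-multichain is a j-chain with repetitions, and every j-chain arises
-- from C(m,j) of them; counting elements with multiplicity instead, the weights add up to
-- C(m+1,j+1) W_j.  So (2)/(3) and (4)/(5) say that the sequences a and b have the same image
-- under the lower unitriangular matrices (C(m,j)) and (C(m+1,j+1)), which for m ≤ r is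
-- equivalent to a_k = b_k for k ≤ r; above r there are no chains and a_k = b_k = 0.
-- The binomial expansions are proved for multichains with a fixed least element p, by induction
-- on m: splitting off p leaves a multichain starting at p or strictly above p, and Pascal's rule
-- recombines the two halves.

module Submission where

open import Defs
open import Data.Nat using (ℕ; zero; suc; _+_; _*_; _≤_; _<_; _≤?_; _≤′_; ≤′-refl; ≤′-step; z≤n; s≤s)
open import Data.Nat.Properties
open import Data.Nat.ListAction using (sum)
open import Data.Nat.Combinatorics using (_C_; nCk+nC[k+1]≡[n+1]C[k+1]; k>n⇒nCk≡0; nCn≡1; nC1≡n)
open import Data.Nat.Tactic.RingSolver using (solve-∀)
import Data.Integer as ℤ
import Data.Integer.Properties as ℤ
import Data.Integer.Tactic.RingSolver as ℤSolver
open import Data.Rational as ℚ using (toℚᵘ)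
import Data.Rational.Properties as ℚ
open import Data.Rational.Unnormalised as ℚᵘ using (ℚᵘ; mkℚᵘ; *≡*)
import Data.Rational.Unnormalised.Properties as ℚᵘ
open import Data.Fin using (Fin; zero; suc)
import Data.Fin.Properties as Fin
open import Data.Vec as Vec using (Vec; []; _∷_; head)
open import Data.Vec.Relation.Unary.Any using (here; there)
open import Data.Vec.Membership.Propositional using (_∈_; _∉_)
open import Data.List using (List; []; _∷_; map; filter; length; concatMap; _++_; allFin)
open import Data.List.Properties using (map-tabulate; filter-none)
import Data.List.Relation.Unary.All as All
import Data.List.Relation.Unary.Any as Any
open import Data.List.Membership.Propositional using () renaming (_∈_ to _∈ₗ_)
open import Data.List.Membership.Propositional.Properties using (∈-concatMap⁺; ∈-map⁺; ∈-filter⁺; ∈-allFin)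
open import Data.Bool using (if_then_else_)
open import Data.Sum using (inj₁; inj₂)
open import Data.Empty using (⊥-elim)
open import Data.Product using (Σ; _×_; _,_; proj₁; proj₂)
open import Function using (_∘_; id)
open import Function.Bundles using (_⇔_; mk⇔; module Equivalence)
open import Function.Construct.Composition using (_⇔-∘_)
open import Relation.Nullary using (Dec; yes; no; does; ¬_)
open import Relation.Nullary.Decidable using (_×-dec_; ¬?)
open import Relation.Unary using (Pred)
open import Relation.Binary.Definitions using (Decidable)
open import Relation.Binary.Structures using (IsPartialOrder)
open import Relation.Binary.PropositionalEquality using (_≡_; refl; sym; trans; cong; cong₂; subst; module ≡-Reasoning)

-- Fractions produced by frac

module _ (P : FinitePoset) where

  private
    [_/1+_] : ℕ → ℕ → ℚᵘ
    [ a /1+ x ] = mkℚᵘ (ℤ.+ a) x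

    ≃⇔≡ : ∀ a x b y → ([ a /1+ x ] ℚᵘ.≃ [ b /1+ y ]) ⇔ (a * suc y ≡ b * suc x)
    ≃⇔≡ a x b y = mk⇔
      (λ { (*≡* eq) → ℤ.+-injective (trans (ℤ.pos-* a (suc y)) (trans eq (sym (ℤ.pos-* b (suc x))))) })
      (λ eq → *≡* (trans (sym (ℤ.pos-* a (suc y))) (trans (cong ℤ.+_ eq) (ℤ.pos-* b (suc x)))))

    -- frac a (suc x) unfolds to fromℚᵘ of the unnormalised fraction a / (1 + x).
    toℚᵘ-frac : ∀ a x → toℚᵘ (frac P a (suc x)) ℚᵘ.≃ [ a /1+ x ]
    toℚᵘ-frac a x = ℚ.toℚᵘ-fromℚᵘ [ a /1+ x ]

  frac-*-integer : ∀ a b x → frac P a 1 ℚ.* frac P b (suc x) ≡ frac P (a * b) (suc x)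
  frac-*-integer a b x = ℚ.toℚᵘ-injective (begin-equality
    toℚᵘ (frac P a 1 ℚ.* frac P b (suc x))          ≃⟨ ℚ.toℚᵘ-homo-* (frac P a 1) (frac P b (suc x)) ⟩
    toℚᵘ (frac P a 1) ℚᵘ.* toℚᵘ (frac P b (suc x))  ≃⟨ ℚᵘ.*-cong (toℚᵘ-frac a 0) (toℚᵘ-frac b x) ⟩
    [ a /1+ 0 ] ℚᵘ.* [ b /1+ x ]                    ≃⟨ *≡* (cong₂ ℤ._*_ (sym (ℤ.pos-* a b)) (cong (λ d → ℤ.+ suc d) (sym (+-identityʳ x)))) ⟩
    [ a * b /1+ x ]                                 ≃⟨ ℚᵘ.≃-sym (toℚᵘ-frac (a * b) x) ⟩
    toℚᵘ (frac P (a * b) (suc x))                   ∎)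
    where open ℚᵘ.≤-Reasoning

  frac-+ : ∀ a b x → frac P a (suc x) ℚ.+ frac P b (suc x) ≡ frac P (a + b) (suc x)
  frac-+ a b x = ℚ.toℚᵘ-injective (begin-equality
    toℚᵘ (frac P a (suc x) ℚ.+ frac P b (suc x))          ≃⟨ ℚ.toℚᵘ-homo-+ (frac P a (suc x)) (frac P b (suc x)) ⟩
    toℚᵘ (frac P a (suc x)) ℚᵘ.+ toℚᵘ (frac P b (suc x))  ≃⟨ ℚᵘ.+-cong (toℚᵘ-frac a x) (toℚᵘ-frac b x) ⟩
    [ a /1+ x ] ℚᵘ.+ [ b /1+ x ]                          ≃⟨ *≡* common-denominator ⟩
    [ a + b /1+ x ]                                       ≃⟨ ℚᵘ.≃-sym (toℚᵘ-frac (a + b) x) ⟩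
    toℚᵘ (frac P (a + b) (suc x))                         ∎)
    where
    open ℚᵘ.≤-Reasoning
    distrib : ∀ a b s → (a ℤ.* s ℤ.+ b ℤ.* s) ℤ.* s ≡ (a ℤ.+ b) ℤ.* (s ℤ.* s)
    distrib = ℤSolver.solve-∀
    common-denominator : (ℤ.+ a ℤ.* ℤ.+ suc x ℤ.+ ℤ.+ b ℤ.* ℤ.+ suc x) ℤ.* ℤ.+ suc x ≡ ℤ.+ (a + b) ℤ.* ℤ.+ (suc x * suc x)
    common-denominator = trans (distrib (ℤ.+ a) (ℤ.+ b) (ℤ.+ suc x))
                               (sym (cong₂ ℤ._*_ (ℤ.pos-+ a b) (ℤ.pos-* (suc x) (suc x))))

  frac-≡⇔ : ∀ A X B Y → 0 < X → 0 < Y → (frac P A X ≡ frac P B Y) ⇔ (A * Y ≡ B * X)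
  frac-≡⇔ A (suc x) B (suc y) _ _ = mk⇔
    (λ eq → Equivalence.to (≃⇔≡ A x B y) (ℚ.fromℚᵘ-injective eq))
    (λ eq → ℚ.fromℚᵘ-cong (Equivalence.from (≃⇔≡ A x B y) eq))

open ≡-Reasoning

-- Indicators and finite sums

𝟙 : ∀ {a} {A : Set a} → Dec A → ℕ
𝟙 A? = if does A? then 1 else 0

𝟙-× : ∀ {a b} {A : Set a} {B : Set b} (A? : Dec A) (B? : Dec B) → 𝟙 (A? ×-dec B?) ≡ 𝟙 A? * 𝟙 B?
𝟙-× (yes _) (yes _) = refl
𝟙-× (yes _) (no _)  = refl
𝟙-× (no _)  _       = refl

𝟙-≟-sym : ∀ {m} (i j : Fin m) → 𝟙 (i Fin.≟ j) ≡ 𝟙 (j Fin.≟ i)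
𝟙-≟-sym i j with i Fin.≟ j | j Fin.≟ i
... | yes _   | yes _   = refl
... | yes i≡j | no j≢i  = ⊥-elim (j≢i (sym i≡j))
... | no i≢j  | yes j≡i = ⊥-elim (i≢j (sym j≡i))
... | no _    | no _    = refl

𝟙-*-cong : ∀ {a} {A : Set a} (A? : Dec A) {x y : ℕ} → (A → x ≡ y) → 𝟙 A? * x ≡ 𝟙 A? * y
𝟙-*-cong (yes a) x≡y = cong (1 *_) (x≡y a)
𝟙-*-cong (no _)  x≡y = refl

𝟙-split : ∀ {a b} {A : Set a} {B : Set b} (A? : Dec A) (B? : Dec B) → (B → A) → 𝟙 A? ≡ 𝟙 B? + 𝟙 A? * 𝟙 (¬? B?)
𝟙-split (yes _) (yes _) B⇒A = refl
𝟙-split (yes _) (no _)  B⇒A = refl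
𝟙-split (no ¬a) (yes b) B⇒A = ⊥-elim (¬a (B⇒A b))
𝟙-split (no _)  (no _)  B⇒A = refl

∑ : {A : Set} → List A → (A → ℕ) → ℕ
∑ xs f = sum (map f xs)

infix 5 ∑
syntax ∑ xs (λ x → e) = ∑[ x ∈ xs ] e

private variable
  A B : Set

∑-cong : (xs : List A) {f g : A → ℕ} → (∀ x → f x ≡ g x) → ∑ xs f ≡ ∑ xs g
∑-cong []       f≗g = refl
∑-cong (x ∷ xs) f≗g = cong₂ _+_ (f≗g x) (∑-cong xs f≗g)

∑-zero : (xs : List A) → ∑[ x ∈ xs ] 0 ≡ 0
∑-zero []       = refl
∑-zero (x ∷ xs) = ∑-zero xs

∑-distrib-+ : (xs : List A) (f g : A → ℕ) → ∑[ x ∈ xs ] (f x + g x) ≡ ∑ xs f + ∑ xs g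
∑-distrib-+ []       f g = refl
∑-distrib-+ (x ∷ xs) f g = begin
  f x + g x + (∑[ x ∈ xs ] (f x + g x)) ≡⟨ cong (f x + g x +_) (∑-distrib-+ xs f g) ⟩
  f x + g x + (∑ xs f + ∑ xs g)       ≡⟨ +-+-interchange (f x) (g x) _ _ ⟩
  f x + ∑ xs f + (g x + ∑ xs g)       ∎
  where
  +-+-interchange : ∀ a b c d → a + b + (c + d) ≡ a + c + (b + d)
  +-+-interchange = solve-∀

∑-distribˡ : (xs : List A) (c : ℕ) (f : A → ℕ) → ∑[ x ∈ xs ] c * f x ≡ c * ∑ xs f
∑-distribˡ []       c f = sym (*-zeroʳ c)
∑-distribˡ (x ∷ xs) c f =
  trans (cong (c * f x +_) (∑-distribˡ xs c f)) (sym (*-distribˡ-+ c (f x) (∑ xs f)))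

∑-const : (xs : List A) (c : ℕ) → ∑[ x ∈ xs ] c ≡ c * length xs
∑-const []       c = sym (*-zeroʳ c)
∑-const (x ∷ xs) c = trans (cong (c +_) (∑-const xs c)) (sym (*-suc c (length xs)))

∑-++ : (xs ys : List A) (f : A → ℕ) → ∑ (xs ++ ys) f ≡ ∑ xs f + ∑ ys f
∑-++ []       ys f = refl
∑-++ (x ∷ xs) ys f = trans (cong (f x +_) (∑-++ xs ys f)) (sym (+-assoc (f x) _ _))

∑-map : (xs : List B) (h : B → A) (f : A → ℕ) → ∑ (map h xs) f ≡ ∑[ x ∈ xs ] f (h x)
∑-map []       h f = refl
∑-map (x ∷ xs) h f = cong (f (h x) +_) (∑-map xs h f)

∑-concatMap : (xs : List B) (h : B → List A) (f : A → ℕ) →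
              ∑ (concatMap h xs) f ≡ ∑[ x ∈ xs ] ∑ (h x) f
∑-concatMap []       h f = refl
∑-concatMap (x ∷ xs) h f = trans (∑-++ (h x) (concatMap h xs) f) (cong (∑ (h x) f +_) (∑-concatMap xs h f))

∑-comm : (xs : List A) (ys : List B) (f : A → B → ℕ) →
         ∑[ x ∈ xs ] ∑[ y ∈ ys ] f x y ≡ ∑[ y ∈ ys ] ∑[ x ∈ xs ] f x y
∑-comm []       ys f = sym (∑-zero ys)
∑-comm (x ∷ xs) ys f = trans (cong (∑ ys (f x) +_) (∑-comm xs ys f))
                             (sym (∑-distrib-+ ys (f x) (λ y → ∑[ x ∈ xs ] f x y)))

∑-filter : ∀ {p} {P : Pred A p} (P? : ∀ x → Dec (P x)) (xs : List A) (f : A → ℕ) →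
           ∑ (filter P? xs) f ≡ ∑[ x ∈ xs ] 𝟙 (P? x) * f x
∑-filter P? []       f = refl
∑-filter P? (x ∷ xs) f with P? x
... | yes _ = cong₂ _+_ (sym (+-identityʳ (f x))) (∑-filter P? xs f)
... | no _  = ∑-filter P? xs f

length-filter≡∑𝟙 : ∀ {p} {P : Pred A p} (P? : ∀ x → Dec (P x)) (xs : List A) →
                   length (filter P? xs) ≡ ∑[ x ∈ xs ] 𝟙 (P? x)
length-filter≡∑𝟙 P? []       = refl
length-filter≡∑𝟙 P? (x ∷ xs) with P? x
... | yes _ = cong suc (length-filter≡∑𝟙 P? xs)
... | no _  = length-filter≡∑𝟙 P? xs

∑-filter-cong : ∀ {p} {P : Pred A p} (P? : ∀ x → Dec (P x)) (xs : List A) {f g : A → ℕ} →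
                (∀ x → P x → f x ≡ g x) → ∑ (filter P? xs) f ≡ ∑ (filter P? xs) g
∑-filter-cong P? []       f≗g = refl
∑-filter-cong P? (x ∷ xs) f≗g with P? x
... | yes px = cong₂ _+_ (f≗g x px) (∑-filter-cong P? xs f≗g)
... | no _   = ∑-filter-cong P? xs f≗g

∑-pull : (xs : List A) (w : A → ℕ) (a : ℕ) (f : A → ℕ) →
         ∑[ x ∈ xs ] w x * (a * f x) ≡ a * (∑[ x ∈ xs ] w x * f x)
∑-pull xs w a f = trans (∑-cong xs (λ x → *-left-comm (w x) a (f x))) (∑-distribˡ xs a _)
  where
  *-left-comm : ∀ w a f → w * (a * f) ≡ a * (w * f)
  *-left-comm = solve-∀

∑-linear : (xs : List A) (w : A → ℕ) (a : ℕ) (f h : A → ℕ) →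
           ∑[ x ∈ xs ] w x * (a * f x + h x) ≡ a * (∑[ x ∈ xs ] w x * f x) + (∑[ x ∈ xs ] w x * h x)
∑-linear xs w a f h = begin
  ∑[ x ∈ xs ] w x * (a * f x + h x)                           ≡⟨ ∑-cong xs (λ x → *-distribˡ-+ (w x) (a * f x) (h x)) ⟩
  ∑[ x ∈ xs ] (w x * (a * f x) + w x * h x)                   ≡⟨ ∑-distrib-+ xs _ _ ⟩
  (∑[ x ∈ xs ] w x * (a * f x)) + (∑[ x ∈ xs ] w x * h x)     ≡⟨ cong (_+ _) (∑-pull xs w a f) ⟩
  a * (∑[ x ∈ xs ] w x * f x) + (∑[ x ∈ xs ] w x * h x)       ∎

∑-allFin-suc : ∀ {m} (f : Fin (suc m) → ℕ) → ∑ (allFin (suc m)) f ≡ f zero + (∑[ i ∈ allFin m ] f (suc i))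
∑-allFin-suc {m} f =
  cong (λ xs → f zero + sum xs) (trans (map-tabulate suc f) (sym (map-tabulate id (f ∘ suc))))

∑-δ : ∀ {m} (p : Fin m) (f : Fin m → ℕ) → ∑[ q ∈ allFin m ] 𝟙 (q Fin.≟ p) * f q ≡ f p
∑-δ {suc m} p f = trans (∑-allFin-suc (λ q → 𝟙 (q Fin.≟ p) * f q)) (split p)
  where
  split : ∀ p → 𝟙 (zero Fin.≟ p) * f zero + (∑[ q ∈ allFin m ] 𝟙 (suc q Fin.≟ p) * f (suc q)) ≡ f p
  split zero    = trans (cong (f zero + 0 +_) (∑-zero (allFin m))) (trans (+-identityʳ _) (+-identityʳ _))
  split (suc p) = ∑-δ p (f ∘ suc)

-- Lower-triangular transforms of sequences

∑< : ℕ → (ℕ → ℕ) → ℕ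
∑< zero    f = 0
∑< (suc L) f = f 0 + ∑< L (f ∘ suc)

infix 5 ∑<
syntax ∑< L (λ j → e) = ∑[ j < L ] e

∑<-cong< : ∀ L {f g : ℕ → ℕ} → (∀ j → j < L → f j ≡ g j) → ∑< L f ≡ ∑< L g
∑<-cong< zero    f≗g = refl
∑<-cong< (suc L) f≗g = cong₂ _+_ (f≗g 0 (s≤s z≤n)) (∑<-cong< L (λ j j<L → f≗g (suc j) (s≤s j<L)))

∑<-cong : ∀ L {f g : ℕ → ℕ} → (∀ j → f j ≡ g j) → ∑< L f ≡ ∑< L g
∑<-cong L f≗g = ∑<-cong< L (λ j _ → f≗g j)

∑<-distrib-+ : ∀ L (f g : ℕ → ℕ) → ∑[ j < L ] (f j + g j) ≡ ∑< L f + ∑< L g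
∑<-distrib-+ zero    f g = refl
∑<-distrib-+ (suc L) f g = begin
  f 0 + g 0 + (∑[ j < L ] (f (suc j) + g (suc j))) ≡⟨ cong (f 0 + g 0 +_) (∑<-distrib-+ L (f ∘ suc) (g ∘ suc)) ⟩
  f 0 + g 0 + (∑< L (f ∘ suc) + ∑< L (g ∘ suc))   ≡⟨ +-+-interchange (f 0) (g 0) _ _ ⟩
  f 0 + ∑< L (f ∘ suc) + (g 0 + ∑< L (g ∘ suc))   ∎
  where
  +-+-interchange : ∀ a b c d → a + b + (c + d) ≡ a + c + (b + d)
  +-+-interchange = solve-∀

∑<-distribˡ : ∀ L (c : ℕ) (f : ℕ → ℕ) → ∑[ j < L ] c * f j ≡ c * ∑< L f
∑<-distribˡ zero    c f = sym (*-zeroʳ c)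
∑<-distribˡ (suc L) c f =
  trans (cong (c * f 0 +_) (∑<-distribˡ L c (f ∘ suc))) (sym (*-distribˡ-+ c (f 0) _))

∑<-snoc : ∀ L (f : ℕ → ℕ) → ∑< (suc L) f ≡ ∑< L f + f L
∑<-snoc zero    f = +-comm (f 0) 0
∑<-snoc (suc L) f = trans (cong (f 0 +_) (∑<-snoc L (f ∘ suc))) (sym (+-assoc (f 0) _ _))

∑-∑< : (xs : List A) (L : ℕ) (f : ℕ → A → ℕ) →
       ∑[ x ∈ xs ] ∑[ j < L ] f j x ≡ ∑[ j < L ] ∑[ x ∈ xs ] f j x
∑-∑< xs zero    f = ∑-zero xs
∑-∑< xs (suc L) f = trans (∑-distrib-+ xs (f 0) (λ x → ∑[ j < L ] f (suc j) x))
                          (cong (∑ xs (f 0) +_) (∑-∑< xs L (f ∘ suc)))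

infixl 7 _⊛_
_⊛_ : (ℕ → ℕ → ℕ) → (ℕ → ℕ) → ℕ → ℕ
(c ⊛ f) m = ∑[ j < suc m ] c m j * f j

infixl 6.5 _C⁺_
_C⁺_ : ℕ → ℕ → ℕ
m C⁺ j = suc m C suc j

⊛-cong : ∀ c {f g : ℕ → ℕ} → (∀ j → f j ≡ g j) → ∀ m → (c ⊛ f) m ≡ (c ⊛ g) m
⊛-cong c f≗g m = ∑<-cong (suc m) (λ j → cong (c m j *_) (f≗g j))

⊛-distribˡ : ∀ c (d : ℕ) (f : ℕ → ℕ) m → d * (c ⊛ f) m ≡ (c ⊛ (λ j → d * f j)) m
⊛-distribˡ c d f m = trans (sym (∑<-distribˡ (suc m) d (λ j → c m j * f j)))
                           (∑<-cong (suc m) (λ j → *-left-comm d (c m j) (f j)))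
  where
  *-left-comm : ∀ a b x → a * (b * x) ≡ b * (a * x)
  *-left-comm = solve-∀

⊛-distribʳ : ∀ c (d : ℕ) (f : ℕ → ℕ) m → (c ⊛ f) m * d ≡ (c ⊛ (λ j → f j * d)) m
⊛-distribʳ c d f m = trans (*-comm _ d) (trans (⊛-distribˡ c d f m) (⊛-cong c (λ j → *-comm d (f j)) m))

⊛-distrib-+ : ∀ c (f g : ℕ → ℕ) m → (c ⊛ (λ j → f j + g j)) m ≡ (c ⊛ f) m + (c ⊛ g) m
⊛-distrib-+ c f g m = trans (∑<-cong (suc m) (λ j → *-distribˡ-+ (c m j) (f j) (g j)))
                            (∑<-distrib-+ (suc m) (λ j → c m j * f j) (λ j → c m j * g j))

∑-⊛ : (xs : List A) (c : ℕ → ℕ → ℕ) (f : ℕ → A → ℕ) (m : ℕ) →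
      ∑[ x ∈ xs ] (c ⊛ (λ j → f j x)) m ≡ (c ⊛ (λ j → ∑[ x ∈ xs ] f j x)) m
∑-⊛ xs c f m = trans (∑-∑< xs (suc m) (λ j x → c m j * f j x))
                     (∑<-cong (suc m) (λ j → ∑-distribˡ xs (c m j) (f j)))

⊛-extend : ∀ c (f : ℕ → ℕ) m → c m (suc m) ≡ 0 → ∑[ j < suc (suc m) ] c m j * f j ≡ (c ⊛ f) m
⊛-extend c f m top≡0 = begin
  ∑[ j < suc (suc m) ] c m j * f j             ≡⟨ ∑<-snoc (suc m) (λ j → c m j * f j) ⟩
  (c ⊛ f) m + c m (suc m) * f (suc m)          ≡⟨ cong (λ x → (c ⊛ f) m + x * f (suc m)) top≡0 ⟩
  (c ⊛ f) m + 0                                ≡⟨ +-identityʳ _ ⟩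
  (c ⊛ f) m                                    ∎

C-⊛-suc : ∀ (f : ℕ → ℕ) m → (_C_ ⊛ f) (suc m) ≡ (_C_ ⊛ f) m + (_C_ ⊛ (f ∘ suc)) m
C-⊛-suc f m = begin
  (_C_ ⊛ f) (suc m)
    ≡⟨ cong (1 * f 0 +_) (∑<-cong (suc m) (λ j → cong (_* f (suc j)) (sym (nCk+nC[k+1]≡[n+1]C[k+1] m j)))) ⟩
  1 * f 0 + (∑[ j < suc m ] (m C j + m C suc j) * f (suc j))
    ≡⟨ cong (1 * f 0 +_) (trans (∑<-cong (suc m) (λ j → *-distribʳ-+ (f (suc j)) (m C j) (m C suc j)))
                                (∑<-distrib-+ (suc m) (λ j → (m C j) * f (suc j)) (λ j → (m C suc j) * f (suc j)))) ⟩
  1 * f 0 + (Shifted + (∑[ j < suc m ] (m C suc j) * f (suc j)))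
    ≡⟨ +-left-comm (1 * f 0) Shifted _ ⟩
  Shifted + (∑[ j < suc (suc m) ] (m C j) * f j)
    ≡⟨ cong (Shifted +_) (⊛-extend _C_ f m (k>n⇒nCk≡0 (n<1+n m))) ⟩
  Shifted + (_C_ ⊛ f) m
    ≡⟨ +-comm Shifted _ ⟩
  (_C_ ⊛ f) m + Shifted ∎
  where
  Shifted : ℕ
  Shifted = (_C_ ⊛ (f ∘ suc)) m
  +-left-comm : ∀ a b c → a + (b + c) ≡ b + (a + c)
  +-left-comm = solve-∀

C⁺-⊛-suc : ∀ (f : ℕ → ℕ) m → (_C⁺_ ⊛ f) (suc m) ≡ (_C⁺_ ⊛ f) m + (_C_ ⊛ f) (suc m)
C⁺-⊛-suc f m = begin
  (_C⁺_ ⊛ f) (suc m)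
    ≡⟨ ∑<-cong (suc (suc m)) (λ j → cong (_* f j) (sym (nCk+nC[k+1]≡[n+1]C[k+1] (suc m) j))) ⟩
  ∑[ j < suc (suc m) ] (suc m C j + m C⁺ j) * f j
    ≡⟨ trans (∑<-cong (suc (suc m)) (λ j → *-distribʳ-+ (f j) (suc m C j) (m C⁺ j)))
             (∑<-distrib-+ (suc (suc m)) (λ j → (suc m C j) * f j) (λ j → (m C⁺ j) * f j)) ⟩
  (_C_ ⊛ f) (suc m) + (∑[ j < suc (suc m) ] (m C⁺ j) * f j)
    ≡⟨ cong ((_C_ ⊛ f) (suc m) +_) (⊛-extend _C⁺_ f m (k>n⇒nCk≡0 (n<1+n (suc m)))) ⟩
  (_C_ ⊛ f) (suc m) + (_C⁺_ ⊛ f) m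
    ≡⟨ +-comm ((_C_ ⊛ f) (suc m)) ((_C⁺_ ⊛ f) m) ⟩
  (_C⁺_ ⊛ f) m + (_C_ ⊛ f) (suc m) ∎

C-⊛-suc-head : ∀ (f : ℕ → ℕ) m → (_C_ ⊛ f) (suc m) ≡ f 0 + (_C⁺_ ⊛ (f ∘ suc)) m
C-⊛-suc-head f m = cong (_+ (_C⁺_ ⊛ (f ∘ suc)) m) (*-identityˡ (f 0))

⊛-positive : ∀ c (f : ℕ → ℕ) m → 0 < c m 0 → 0 < f 0 → 0 < (c ⊛ f) m
⊛-positive c f m 0<c 0<f = ≤-trans (*-mono-≤ 0<c 0<f) (m≤m+n (c m 0 * f 0) _)

module _ (c : ℕ → ℕ → ℕ) (unit-diagonal : ∀ m → c m m ≡ 1) {K : ℕ} {f g : ℕ → ℕ}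
         (c⊛f≡c⊛g : ∀ m → m ≤ K → (c ⊛ f) m ≡ (c ⊛ g) m) where

  private
    agreeAt : ∀ k → k ≤ K → (∀ j → j < k → f j ≡ g j) → f k ≡ g k
    agreeAt k k≤K below = begin
      f k            ≡⟨ sym (*-identityˡ (f k)) ⟩
      1 * f k        ≡⟨ cong (_* f k) (sym (unit-diagonal k)) ⟩
      c k k * f k    ≡⟨ +-cancelˡ-≡ _ _ _ prefixes ⟩
      c k k * g k    ≡⟨ cong (_* g k) (unit-diagonal k) ⟩
      1 * g k        ≡⟨ *-identityˡ (g k) ⟩
      g k            ∎
      where
      prefix≡ : ∑[ j < k ] c k j * f j ≡ ∑[ j < k ] c k j * g j
      prefix≡ = ∑<-cong< k (λ j j<k → cong (c k j *_) (below j j<k))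
      prefixes : (∑[ j < k ] c k j * g j) + c k k * f k ≡ (∑[ j < k ] c k j * g j) + c k k * g k
      prefixes = begin
        (∑[ j < k ] c k j * g j) + c k k * f k  ≡⟨ cong (_+ c k k * f k) (sym prefix≡) ⟩
        (∑[ j < k ] c k j * f j) + c k k * f k  ≡⟨ sym (∑<-snoc k (λ j → c k j * f j)) ⟩
        (c ⊛ f) k                             ≡⟨ c⊛f≡c⊛g k k≤K ⟩
        (c ⊛ g) k                             ≡⟨ ∑<-snoc k (λ j → c k j * g j) ⟩
        (∑[ j < k ] c k j * g j) + c k k * g k  ∎

    agreeBelow : ∀ k → k ≤ K → ∀ j → j < k → f j ≡ g j
    agreeBelow (suc k) 1+k≤K j j<1+k with m<1+n⇒m<n∨m≡n j<1+k
    ... | inj₁ j<k  = agreeBelow k (<⇒≤ 1+k≤K) j j<k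
    ... | inj₂ refl = agreeAt j (<⇒≤ 1+k≤K) (agreeBelow j (<⇒≤ 1+k≤K))

  ⊛-unitriangular-injective : ∀ k → k ≤ K → f k ≡ g k
  ⊛-unitriangular-injective k k≤K = agreeAt k k≤K (agreeBelow k k≤K)

module _ (c : ℕ → ℕ → ℕ) (unit-diagonal : ∀ m → c m m ≡ 1) {r : ℕ} {f g : ℕ → ℕ}
         (agree-above : ∀ k → r < k → f k ≡ g k)
         {A B : ℕ → Set} (A⇔ : ∀ k → k ≤ r → A k ⇔ (f k ≡ g k)) (B⇔ : ∀ m → B m ⇔ ((c ⊛ f) m ≡ (c ⊛ g) m)) where

  private
    agree : (∀ k → k ≤ r → A k) → ∀ k → f k ≡ g k
    agree A≤r k with k ≤? r
    ... | yes k≤r = Equivalence.to (A⇔ k k≤r) (A≤r k k≤r)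
    ... | no  k≰r = agree-above k (≰⇒> k≰r)

    to : (∀ k → k ≤ r → A k) → ∀ m → B m
    to A≤r m = Equivalence.from (B⇔ m) (⊛-cong c (agree A≤r) m)

    from : (∀ m → m ≤ r → B m) → ∀ k → k ≤ r → A k
    from B≤r k k≤r = Equivalence.from (A⇔ k k≤r)
      (⊛-unitriangular-injective c unit-diagonal {f = f} {g} (λ m m≤r → Equivalence.to (B⇔ m) (B≤r m m≤r)) k k≤r)

  ⊛-unitriangular-conditions :
    ((∀ k → k ≤ r → A k) ⇔ (∀ m → B m)) × ((∀ k → k ≤ r → A k) ⇔ (∀ m → m ≤ r → B m))
  ⊛-unitriangular-conditions = mk⇔ to (λ B-all → from (λ m _ → B-all m)) , mk⇔ (λ A≤r m _ → to A≤r m) from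

-- Weighted sums over chains and multichains

module _ (P : FinitePoset) where
  open FinitePoset P
  open IsPartialOrder isPartialOrder using (antisym) renaming (refl to ≼-refl; trans to ≼-trans)

  private
    variable
      k : ℕ
    infix 4 _≺?′_ _∈?′_
    _≺?′_ : Decidable (_≺_ P)
    _≺?′_ = _≺?_ P
    _∈?′_ : (p : El P) (c : Vec (El P) k) → Dec (p ∈ c)
    _∈?′_ = _∈?_ P

  elems : List (El P)
  elems = allFin size

  sumℚ-frac : {A : Set} (xs : List A) (f N : A → ℕ) (X : ℕ) →
              sumℚ P (map (λ x → frac P (f x) 1 ℚ.* frac P (N x) X) xs) ≡ frac P (∑[ x ∈ xs ] f x * N x) X
  sumℚ-frac []       f N zero    = refl
  sumℚ-frac []       f N (suc X) = sym (ℚ.0/n≡0 (suc X))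
  sumℚ-frac (x ∷ xs) f N zero    =
    cong₂ ℚ._+_ (ℚ.*-zeroʳ (frac P (f x) 1)) (sumℚ-frac xs f N zero)
  sumℚ-frac (x ∷ xs) f N (suc X) =
    trans (cong₂ ℚ._+_ (frac-*-integer P (f x) (N x) X) (sumℚ-frac xs f N (suc X)))
          (frac-+ P (f x * N x) _ X)

  𝔼-frac : (N : El P → ℕ) (X : ℕ) (f : El P → ℕ) →
           𝔼 P (λ p → frac P (N p) X) f ≡ frac P (∑[ p ∈ elems ] f p * N p) X
  𝔼-frac N X f = sumℚ-frac (allFin _) f N X

  supportWeight : (El P → ℕ) → Vec (El P) k → ℕ
  supportWeight g c = ∑[ q ∈ elems ] 𝟙 (q ∈?′ c) * g q

  entryWeight : (El P → ℕ) → Vec (El P) k → ℕ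
  entryWeight g c = Vec.sum (Vec.map g c)

  supportWeight-∷ : (g : El P → ℕ) (p : El P) (c : Vec (El P) k) →
                    supportWeight g (p ∷ c) ≡ 𝟙 (¬? (p ∈?′ c)) * g p + supportWeight g c
  supportWeight-∷ g p c = begin
    supportWeight g (p ∷ c)
      ≡⟨ ∑-cong elems pointwise ⟩
    ∑[ q ∈ elems ] (𝟙 (q Fin.≟ p) * (𝟙 (¬? (p ∈?′ c)) * g p) + 𝟙 (q ∈?′ c) * g q)
      ≡⟨ ∑-distrib-+ elems _ _ ⟩
    (∑[ q ∈ elems ] 𝟙 (q Fin.≟ p) * (𝟙 (¬? (p ∈?′ c)) * g p)) + supportWeight g c
      ≡⟨ cong (_+ supportWeight g c) (∑-δ p (λ _ → 𝟙 (¬? (p ∈?′ c)) * g p)) ⟩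
    𝟙 (¬? (p ∈?′ c)) * g p + supportWeight g c ∎
    where
    pointwise : ∀ q → 𝟙 (q ∈?′ (p ∷ c)) * g q ≡ 𝟙 (q Fin.≟ p) * (𝟙 (¬? (p ∈?′ c)) * g p) + 𝟙 (q ∈?′ c) * g q
    pointwise q with q Fin.≟ p
    pointwise q | yes refl with q ∈?′ (q ∷ c) | q ∈?′ c
    ... | yes _    | yes _ = refl
    ... | yes _    | no _  = sym (trans (+-identityʳ _) (+-identityʳ _))
    ... | no q∉q∷c | _     = ⊥-elim (q∉q∷c (here refl))
    pointwise q | no q≢p with q ∈?′ (p ∷ c) | q ∈?′ c
    ... | yes _           | yes _   = refl
    ... | yes (here q≡p)  | no _    = ⊥-elim (q≢p q≡p)
    ... | yes (there q∈c) | no q∉c  = ⊥-elim (q∉c q∈c)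
    ... | no q∉p∷c        | yes q∈c = ⊥-elim (q∉p∷c (there q∈c))
    ... | no _            | no _    = refl

  multichain-head-least : ∀ {y q} {c : Vec (El P) k} → IsMultichain P (y ∷ c) → q ∈ y ∷ c → y ≼ q
  multichain-head-least _                      (here refl)  = ≼-refl
  multichain-head-least {c = z ∷ c} (y≼z , mc) (there q∈c) = ≼-trans y≼z (multichain-head-least mc q∈c)

  chain⇒multichain : (c : Vec (El P) k) → IsChain P c → IsMultichain P c
  chain⇒multichain []          _                     = _
  chain⇒multichain (x ∷ [])    _                     = _
  chain⇒multichain (x ∷ y ∷ c) ((x≼y , _) , chain) = x≼y , chain⇒multichain (y ∷ c) chain

  ≼-multichain-∈⇒≡ : ∀ {p y} {c : Vec (El P) k} → p ≼ y → IsMultichain P (y ∷ c) → p ∈ y ∷ c → p ≡ y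
  ≼-multichain-∈⇒≡ p≼y mc p∈ = antisym p≼y (multichain-head-least mc p∈)

  ≺-chain-∉ : ∀ {p y} {c : Vec (El P) k} → _≺_ P p y → IsChain P (y ∷ c) → p ∉ y ∷ c
  ≺-chain-∉ {c = c} (p≼y , p≢y) chain p∈ = p≢y (≼-multichain-∈⇒≡ p≼y (chain⇒multichain (_ ∷ c) chain) p∈)

  ≺-chain-supportWeight-∷ : (g : El P → ℕ) {p y : El P} {c : Vec (El P) k} → _≺_ P p y → IsChain P (y ∷ c) →
                           supportWeight g (p ∷ y ∷ c) ≡ g p + supportWeight g (y ∷ c)
  ≺-chain-supportWeight-∷ g {p} {y} {c} p≺y chain =
    trans (supportWeight-∷ g p (y ∷ c)) (cong (_+ supportWeight g (y ∷ c)) (head-counted (p ∈?′ y ∷ c)))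
    where
    head-counted : (p∈? : Dec (p ∈ y ∷ c)) → 𝟙 (¬? p∈?) * g p ≡ g p
    head-counted (yes p∈) = ⊥-elim (≺-chain-∉ p≺y chain p∈)
    head-counted (no _)   = +-identityʳ (g p)

  ≼-multichain-supportWeight-∷ : (g : El P → ℕ) {p y : El P} {c : Vec (El P) k} → p ≼ y → IsMultichain P (y ∷ c) →
                                 supportWeight g (p ∷ y ∷ c) ≡ 𝟙 (¬? (p Fin.≟ y)) * g p + supportWeight g (y ∷ c)
  ≼-multichain-supportWeight-∷ g {p} {y} {c} p≼y mc =
    trans (supportWeight-∷ g p (y ∷ c)) (cong (λ n → n * g p + supportWeight g (y ∷ c)) (head-counted (p ∈?′ y ∷ c) (p Fin.≟ y)))
    where
    head-counted : (p∈? : Dec (p ∈ y ∷ c)) (p≟y : Dec (p ≡ y)) → 𝟙 (¬? p∈?) ≡ 𝟙 (¬? p≟y)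
    head-counted (yes _)  (yes _)   = refl
    head-counted (yes p∈) (no p≢y)  = ⊥-elim (p≢y (≼-multichain-∈⇒≡ p≼y mc p∈))
    head-counted (no p∉)  (yes p≡y) = ⊥-elim (p∉ (here p≡y))
    head-counted (no _)   (no _)    = refl

  chain-supportWeight : (g : El P → ℕ) (c : Vec (El P) k) → IsChain P c → supportWeight g c ≡ entryWeight g c
  chain-supportWeight g []          _     = ∑-zero elems
  chain-supportWeight g (p ∷ [])    _     =
    trans (supportWeight-∷ g p []) (trans (cong (g p + 0 +_) (∑-zero elems)) (+-identityʳ _))
  chain-supportWeight g (p ∷ y ∷ c) (p≺y , chain) =
    trans (≺-chain-supportWeight-∷ g p≺y chain) (cong (g p +_) (chain-supportWeight g (y ∷ c) chain))

  entryWeight-const : (a : ℕ) (c : Vec (El P) k) → entryWeight (λ _ → a) c ≡ k * a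
  entryWeight-const a []      = refl
  entryWeight-const a (x ∷ c) = cong (a +_) (entryWeight-const a c)

  occurrences-∷ : (p x : El P) (c : Vec (El P) k) → occurrences P p (x ∷ c) ≡ 𝟙 (x Fin.≟ p) + occurrences P p c
  occurrences-∷ {k} p x c = begin
    occurrences P p (x ∷ c)                                                    ≡⟨ length-filter≡∑𝟙 _ (allFin (suc k)) ⟩
    ∑[ i ∈ allFin (suc k) ] 𝟙 (Vec.lookup (x ∷ c) i Fin.≟ p)                  ≡⟨ ∑-allFin-suc (λ i → 𝟙 (Vec.lookup (x ∷ c) i Fin.≟ p)) ⟩
    𝟙 (x Fin.≟ p) + (∑[ i ∈ allFin k ] 𝟙 (Vec.lookup c i Fin.≟ p))           ≡⟨ cong (𝟙 (x Fin.≟ p) +_) (sym (length-filter≡∑𝟙 _ (allFin k))) ⟩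
    𝟙 (x Fin.≟ p) + occurrences P p c                                          ∎

  ∑-occurrences : (g : El P → ℕ) (c : Vec (El P) k) → ∑[ p ∈ elems ] g p * occurrences P p c ≡ entryWeight g c
  ∑-occurrences g []      = trans (∑-cong elems (λ p → *-zeroʳ (g p))) (∑-zero elems)
  ∑-occurrences g (x ∷ c) = begin
    ∑[ p ∈ elems ] g p * occurrences P p (x ∷ c)
      ≡⟨ ∑-cong elems (λ p → trans (cong (g p *_) (occurrences-∷ p x c)) (split p)) ⟩
    ∑[ p ∈ elems ] (𝟙 (p Fin.≟ x) * g p + g p * occurrences P p c)
      ≡⟨ ∑-distrib-+ elems _ _ ⟩
    (∑[ p ∈ elems ] 𝟙 (p Fin.≟ x) * g p) + (∑[ p ∈ elems ] g p * occurrences P p c)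
      ≡⟨ cong₂ _+_ (∑-δ x g) (∑-occurrences g c) ⟩
    g x + entryWeight g c ∎
    where
    split : ∀ p → g p * (𝟙 (x Fin.≟ p) + occurrences P p c) ≡ 𝟙 (p Fin.≟ x) * g p + g p * occurrences P p c
    split p = trans (*-distribˡ-+ (g p) _ _) (cong (_+ g p * occurrences P p c) (trans (*-comm (g p) _) (cong (_* g p) (𝟙-≟-sym x p))))

  ∑-weighted-membership : (g : El P → ℕ) (cs : List (Vec (El P) k)) →
                          ∑[ p ∈ elems ] g p * length (filter (p ∈?′_) cs) ≡ ∑[ c ∈ cs ] supportWeight g c
  ∑-weighted-membership g cs = begin
    ∑[ p ∈ elems ] g p * length (filter (p ∈?′_) cs)   ≡⟨ ∑-cong elems (λ p → cong (g p *_) (length-filter≡∑𝟙 (p ∈?′_) cs)) ⟩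
    ∑[ p ∈ elems ] g p * (∑[ c ∈ cs ] 𝟙 (p ∈?′ c))     ≡⟨ ∑-cong elems (λ p → sym (∑-distribˡ cs (g p) _)) ⟩
    ∑[ p ∈ elems ] ∑[ c ∈ cs ] g p * 𝟙 (p ∈?′ c)       ≡⟨ ∑-comm elems cs _ ⟩
    ∑[ c ∈ cs ] ∑[ p ∈ elems ] g p * 𝟙 (p ∈?′ c)       ≡⟨ ∑-cong cs (λ c → ∑-cong elems (λ p → *-comm (g p) _)) ⟩
    ∑[ c ∈ cs ] supportWeight g c                      ∎

  ∑-weighted-occurrences : (g : El P → ℕ) (cs : List (Vec (El P) k)) →
                           ∑[ p ∈ elems ] g p * (∑[ c ∈ cs ] occurrences P p c) ≡ ∑[ c ∈ cs ] entryWeight g c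
  ∑-weighted-occurrences g cs = begin
    ∑[ p ∈ elems ] g p * (∑[ c ∈ cs ] occurrences P p c)   ≡⟨ ∑-cong elems (λ p → sym (∑-distribˡ cs (g p) _)) ⟩
    ∑[ p ∈ elems ] ∑[ c ∈ cs ] g p * occurrences P p c     ≡⟨ ∑-comm elems cs _ ⟩
    ∑[ c ∈ cs ] ∑[ p ∈ elems ] g p * occurrences P p c     ≡⟨ ∑-cong cs (∑-occurrences g) ⟩
    ∑[ c ∈ cs ] entryWeight g c                            ∎

  ∑-allVecs-suc : ∀ j (F : Vec (El P) (suc j) → ℕ) → ∑ (allVecs P (suc j)) F ≡ ∑[ y ∈ elems ] ∑[ c ∈ allVecs P j ] F (y ∷ c)
  ∑-allVecs-suc j F = trans (∑-concatMap elems (λ y → map (y ∷_) (allVecs P j)) F)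
                            (∑-cong elems (λ y → ∑-map (allVecs P j) (y ∷_) F))

  module Rooted {R : El P → El P → Set} (R? : Decidable R)
                {Q : ∀ {k} → Vec (El P) k → Set} (Q? : ∀ {k} (c : Vec (El P) k) → Dec (Q c))
                (Q?-singleton : ∀ p → 𝟙 (Q? (p ∷ [])) ≡ 1)
                (Q?-∷ : ∀ {k} p y (c : Vec (El P) k) → 𝟙 (Q? (p ∷ y ∷ c)) ≡ 𝟙 (R? p y) * 𝟙 (Q? (y ∷ c))) where

    from : (∀ {k} → Vec (El P) k → ℕ) → ℕ → El P → ℕ
    from W j p = ∑[ c ∈ allVecs P j ] 𝟙 (Q? (p ∷ c)) * W (p ∷ c)

    count : ℕ → El P → ℕ
    count = from (λ _ → 1)

    from-zero : (W : ∀ {k} → Vec (El P) k → ℕ) (p : El P) → from W 0 p ≡ W (p ∷ [])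
    from-zero W p = trans (+-identityʳ _) (trans (cong (_* W (p ∷ [])) (Q?-singleton p)) (*-identityˡ _))

    ∑-filter≡∑from : (W : ∀ {k} → Vec (El P) k → ℕ) (j : ℕ) →
                     ∑ (filter Q? (allVecs P (suc j))) W ≡ ∑[ p ∈ elems ] from W j p
    ∑-filter≡∑from W j = trans (∑-filter Q? (allVecs P (suc j)) W)
                                (∑-allVecs-suc j (λ c → 𝟙 (Q? c) * W c))

    from-suc : (W : ∀ {k} → Vec (El P) k → ℕ) (α : El P → El P → ℕ) →
               (∀ {k} p y (c : Vec (El P) k) →
                  𝟙 (Q? (p ∷ y ∷ c)) * W (p ∷ y ∷ c) ≡ 𝟙 (Q? (p ∷ y ∷ c)) * (α p y + W (y ∷ c))) →
               ∀ j p → from W (suc j) p ≡ ∑[ y ∈ elems ] 𝟙 (R? p y) * (α p y * count j y + from W j y)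
    from-suc W α W-∷ j p = begin
      from W (suc j) p
        ≡⟨ ∑-allVecs-suc j (λ c → 𝟙 (Q? (p ∷ c)) * W (p ∷ c)) ⟩
      ∑[ y ∈ elems ] ∑[ c ∈ allVecs P j ] 𝟙 (Q? (p ∷ y ∷ c)) * W (p ∷ y ∷ c)
        ≡⟨ ∑-cong elems (λ y → ∑-cong (allVecs P j) (term y)) ⟩
      ∑[ y ∈ elems ] ∑[ c ∈ allVecs P j ] 𝟙 (R? p y) * (α p y * (𝟙 (Q? (y ∷ c)) * 1) + 𝟙 (Q? (y ∷ c)) * W (y ∷ c))
        ≡⟨ ∑-cong elems (λ y → trans (∑-distribˡ (allVecs P j) (𝟙 (R? p y)) _)
                                     (cong (𝟙 (R? p y) *_) (trans (∑-distrib-+ (allVecs P j) _ _)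
                                                                   (cong (_+ from W j y) (∑-distribˡ (allVecs P j) (α p y) _))))) ⟩
      ∑[ y ∈ elems ] 𝟙 (R? p y) * (α p y * count j y + from W j y) ∎
      where
      distribute : ∀ r q a w → r * q * (a + w) ≡ r * (a * (q * 1) + q * w)
      distribute = solve-∀
      term : ∀ y (c : Vec (El P) j) →
             𝟙 (Q? (p ∷ y ∷ c)) * W (p ∷ y ∷ c) ≡ 𝟙 (R? p y) * (α p y * (𝟙 (Q? (y ∷ c)) * 1) + 𝟙 (Q? (y ∷ c)) * W (y ∷ c))
      term y c = begin
        𝟙 (Q? (p ∷ y ∷ c)) * W (p ∷ y ∷ c)              ≡⟨ W-∷ p y c ⟩
        𝟙 (Q? (p ∷ y ∷ c)) * (α p y + W (y ∷ c))        ≡⟨ cong (_* (α p y + W (y ∷ c))) (Q?-∷ p y c) ⟩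
        𝟙 (R? p y) * 𝟙 (Q? (y ∷ c)) * (α p y + W (y ∷ c)) ≡⟨ distribute (𝟙 (R? p y)) (𝟙 (Q? (y ∷ c))) (α p y) (W (y ∷ c)) ⟩
        𝟙 (R? p y) * (α p y * (𝟙 (Q? (y ∷ c)) * 1) + 𝟙 (Q? (y ∷ c)) * W (y ∷ c)) ∎

    count-suc : ∀ j p → count (suc j) p ≡ ∑[ y ∈ elems ] 𝟙 (R? p y) * count j y
    count-suc = from-suc (λ _ → 1) (λ _ _ → 0) (λ _ _ _ → refl)

  module Chains = Rooted (_≺?_ P) (isChain? P) (λ _ → refl) (λ p y c → 𝟙-× (p ≺?′ y) (isChain? P (y ∷ c)))
  module Multichains = Rooted _≼?_ (isMultichain? P) (λ _ → refl) (λ p y c → 𝟙-× (p ≼? y) (isMultichain? P (y ∷ c)))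

  chainsFrom : ℕ → El P → ℕ
  chainsFrom = Chains.count

  chainWeightFrom : (El P → ℕ) → ℕ → El P → ℕ
  chainWeightFrom g = Chains.from (supportWeight g)

  multichainsFrom : ℕ → El P → ℕ
  multichainsFrom = Multichains.count

  multichainWeightFrom : (El P → ℕ) → ℕ → El P → ℕ
  multichainWeightFrom g = Multichains.from (supportWeight g)

  multichainEntryWeightFrom : (El P → ℕ) → ℕ → El P → ℕ
  multichainEntryWeightFrom g = Multichains.from (entryWeight g)

  upperSum : (El P → ℕ) → El P → ℕ
  upperSum h p = ∑[ y ∈ elems ] 𝟙 (p ≺?′ y) * h y

  ∑-≼≡+upperSum : (h : El P → ℕ) (p : El P) → ∑[ y ∈ elems ] 𝟙 (p ≼? y) * h y ≡ h p + upperSum h p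
  ∑-≼≡+upperSum h p = begin
    ∑[ y ∈ elems ] 𝟙 (p ≼? y) * h y                                    ≡⟨ ∑-cong elems split ⟩
    ∑[ y ∈ elems ] (𝟙 (y Fin.≟ p) * h y + 𝟙 (p ≺?′ y) * h y)           ≡⟨ ∑-distrib-+ elems _ _ ⟩
    (∑[ y ∈ elems ] 𝟙 (y Fin.≟ p) * h y) + upperSum h p                ≡⟨ cong (_+ upperSum h p) (∑-δ p h) ⟩
    h p + upperSum h p                                                 ∎
    where
    split : ∀ y → 𝟙 (p ≼? y) * h y ≡ 𝟙 (y Fin.≟ p) * h y + 𝟙 (p ≺?′ y) * h y
    split y = begin
      𝟙 (p ≼? y) * h y
        ≡⟨ cong (_* h y) (𝟙-split (p ≼? y) (p Fin.≟ y) (λ { refl → ≼-refl })) ⟩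
      (𝟙 (p Fin.≟ y) + 𝟙 (p ≼? y) * 𝟙 (¬? (p Fin.≟ y))) * h y
        ≡⟨ *-distribʳ-+ (h y) (𝟙 (p Fin.≟ y)) (𝟙 (p ≼? y) * 𝟙 (¬? (p Fin.≟ y))) ⟩
      𝟙 (p Fin.≟ y) * h y + 𝟙 (p ≼? y) * 𝟙 (¬? (p Fin.≟ y)) * h y
        ≡⟨ cong₂ (λ a b → a * h y + b * h y) (𝟙-≟-sym p y) (sym (𝟙-× (p ≼? y) (¬? (p Fin.≟ y)))) ⟩
      𝟙 (y Fin.≟ p) * h y + 𝟙 (p ≺?′ y) * h y ∎

  chainsFrom-suc : ∀ j p → chainsFrom (suc j) p ≡ upperSum (chainsFrom j) p
  chainsFrom-suc = Chains.count-suc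

  multichainsFrom-suc : ∀ m p → multichainsFrom (suc m) p ≡ multichainsFrom m p + upperSum (multichainsFrom m) p
  multichainsFrom-suc m p = trans (Multichains.count-suc m p) (∑-≼≡+upperSum (multichainsFrom m) p)

  chainWeightFrom-suc : ∀ g j p → chainWeightFrom g (suc j) p ≡ g p * chainsFrom (suc j) p + upperSum (chainWeightFrom g j) p
  chainWeightFrom-suc g j p =
    trans (Chains.from-suc (supportWeight g) (λ p _ → g p) step j p)
          (trans (∑-linear elems (λ y → 𝟙 (p ≺?′ y)) (g p) (chainsFrom j) (chainWeightFrom g j))
                 (cong (λ n → g p * n + upperSum (chainWeightFrom g j) p) (sym (chainsFrom-suc j p))))
    where
    step : ∀ {k} p y (c : Vec (El P) k) →
           𝟙 (isChain? P (p ∷ y ∷ c)) * supportWeight g (p ∷ y ∷ c) ≡ 𝟙 (isChain? P (p ∷ y ∷ c)) * (g p + supportWeight g (y ∷ c))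
    step p y c = 𝟙-*-cong (isChain? P (p ∷ y ∷ c)) (λ (p≺y , chain) → ≺-chain-supportWeight-∷ g p≺y chain)

  multichainWeightFrom-suc : ∀ g m p → multichainWeightFrom g (suc m) p ≡
    g p * upperSum (multichainsFrom m) p + (multichainWeightFrom g m p + upperSum (multichainWeightFrom g m) p)
  multichainWeightFrom-suc g m p = begin
    multichainWeightFrom g (suc m) p
      ≡⟨ Multichains.from-suc (supportWeight g) (λ p y → 𝟙 (¬? (p Fin.≟ y)) * g p) step m p ⟩
    ∑[ y ∈ elems ] 𝟙 (p ≼? y) * (𝟙 (¬? (p Fin.≟ y)) * g p * multichainsFrom m y + multichainWeightFrom g m y)
      ≡⟨ ∑-cong elems strict-part ⟩
    ∑[ y ∈ elems ] (𝟙 (p ≺?′ y) * (g p * multichainsFrom m y) + 𝟙 (p ≼? y) * multichainWeightFrom g m y)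
      ≡⟨ ∑-distrib-+ elems _ _ ⟩
    (∑[ y ∈ elems ] 𝟙 (p ≺?′ y) * (g p * multichainsFrom m y)) + (∑[ y ∈ elems ] 𝟙 (p ≼? y) * multichainWeightFrom g m y)
      ≡⟨ cong₂ _+_ (∑-pull elems (λ y → 𝟙 (p ≺?′ y)) (g p) (multichainsFrom m))
                   (∑-≼≡+upperSum (multichainWeightFrom g m) p) ⟩
    g p * upperSum (multichainsFrom m) p + (multichainWeightFrom g m p + upperSum (multichainWeightFrom g m) p) ∎
    where
    step : ∀ {k} p y (c : Vec (El P) k) →
           𝟙 (isMultichain? P (p ∷ y ∷ c)) * supportWeight g (p ∷ y ∷ c) ≡
           𝟙 (isMultichain? P (p ∷ y ∷ c)) * (𝟙 (¬? (p Fin.≟ y)) * g p + supportWeight g (y ∷ c))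
    step p y c = 𝟙-*-cong (isMultichain? P (p ∷ y ∷ c)) (λ (p≼y , mc) → ≼-multichain-supportWeight-∷ g p≼y mc)
    regroup : ∀ a b x n v → a * (b * x * n + v) ≡ a * b * (x * n) + a * v
    regroup = solve-∀
    strict-part : ∀ y → 𝟙 (p ≼? y) * (𝟙 (¬? (p Fin.≟ y)) * g p * multichainsFrom m y + multichainWeightFrom g m y) ≡
                        𝟙 (p ≺?′ y) * (g p * multichainsFrom m y) + 𝟙 (p ≼? y) * multichainWeightFrom g m y
    strict-part y = trans (regroup (𝟙 (p ≼? y)) _ (g p) _ _)
                          (cong (λ a → a * (g p * multichainsFrom m y) + 𝟙 (p ≼? y) * multichainWeightFrom g m y) (sym (𝟙-× (p ≼? y) (¬? (p Fin.≟ y)))))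

  multichainEntryWeightFrom-suc : ∀ g m p → multichainEntryWeightFrom g (suc m) p ≡
    g p * multichainsFrom (suc m) p + (multichainEntryWeightFrom g m p + upperSum (multichainEntryWeightFrom g m) p)
  multichainEntryWeightFrom-suc g m p = begin
    multichainEntryWeightFrom g (suc m) p
      ≡⟨ Multichains.from-suc (entryWeight g) (λ p _ → g p) (λ _ _ _ → refl) m p ⟩
    ∑[ y ∈ elems ] 𝟙 (p ≼? y) * (g p * multichainsFrom m y + multichainEntryWeightFrom g m y)
      ≡⟨ ∑-linear elems (λ y → 𝟙 (p ≼? y)) (g p) (multichainsFrom m) (multichainEntryWeightFrom g m) ⟩
    g p * (∑[ y ∈ elems ] 𝟙 (p ≼? y) * multichainsFrom m y) + (∑[ y ∈ elems ] 𝟙 (p ≼? y) * multichainEntryWeightFrom g m y)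
      ≡⟨ cong₂ _+_ (cong (g p *_) (sym (Multichains.count-suc m p))) (∑-≼≡+upperSum (multichainEntryWeightFrom g m) p) ⟩
    g p * multichainsFrom (suc m) p + (multichainEntryWeightFrom g m p + upperSum (multichainEntryWeightFrom g m) p) ∎

  upperSum-cong : {f h : El P → ℕ} → (∀ y → f y ≡ h y) → ∀ p → upperSum f p ≡ upperSum h p
  upperSum-cong f≗h p = ∑-cong elems (λ y → cong (𝟙 (p ≺?′ y) *_) (f≗h y))

  upperSum-⊛ : ∀ c (h : ℕ → El P → ℕ) m p → upperSum (λ y → (c ⊛ (λ j → h j y)) m) p ≡ (c ⊛ (λ j → upperSum (h j) p)) m
  upperSum-⊛ c h m p = trans (∑-cong elems (λ y → ⊛-distribˡ c (𝟙 (p ≺?′ y)) (λ j → h j y) m))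
                             (∑-⊛ elems c (λ j y → 𝟙 (p ≺?′ y) * h j y) m)

  chainWeightFrom-zero : ∀ g p → chainWeightFrom g 0 p ≡ g p
  chainWeightFrom-zero g p = trans (Chains.from-zero (supportWeight g) p)
                                   (trans (chain-supportWeight g (p ∷ []) _) (+-identityʳ (g p)))

  ⊛-chainWeightFrom-suc : ∀ c g m p → (c ⊛ (λ j → chainWeightFrom g (suc j) p)) m ≡
    g p * (c ⊛ (λ j → chainsFrom (suc j) p)) m + (c ⊛ (λ j → upperSum (chainWeightFrom g j) p)) m
  ⊛-chainWeightFrom-suc c g m p = begin
    (c ⊛ (λ j → chainWeightFrom g (suc j) p)) m
      ≡⟨ ⊛-cong c (λ j → chainWeightFrom-suc g j p) m ⟩
    (c ⊛ (λ j → g p * chainsFrom (suc j) p + upperSum (chainWeightFrom g j) p)) m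
      ≡⟨ ⊛-distrib-+ c (λ j → g p * chainsFrom (suc j) p) (λ j → upperSum (chainWeightFrom g j) p) m ⟩
    (c ⊛ (λ j → g p * chainsFrom (suc j) p)) m + (c ⊛ (λ j → upperSum (chainWeightFrom g j) p)) m
      ≡⟨ cong (_+ (c ⊛ (λ j → upperSum (chainWeightFrom g j) p)) m) (sym (⊛-distribˡ c (g p) (λ j → chainsFrom (suc j) p) m)) ⟩
    g p * (c ⊛ (λ j → chainsFrom (suc j) p)) m + (c ⊛ (λ j → upperSum (chainWeightFrom g j) p)) m ∎

  multichainsFrom-⊛ : ∀ m p → multichainsFrom m p ≡ (_C_ ⊛ (λ j → chainsFrom j p)) m
  upperSum-multichainsFrom : ∀ m p → upperSum (multichainsFrom m) p ≡ (_C_ ⊛ (λ j → chainsFrom (suc j) p)) m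

  multichainsFrom-⊛ zero    p = refl
  multichainsFrom-⊛ (suc m) p = begin
    multichainsFrom (suc m) p
      ≡⟨ multichainsFrom-suc m p ⟩
    multichainsFrom m p + upperSum (multichainsFrom m) p
      ≡⟨ cong₂ _+_ (multichainsFrom-⊛ m p) (upperSum-multichainsFrom m p) ⟩
    (_C_ ⊛ (λ j → chainsFrom j p)) m + (_C_ ⊛ (λ j → chainsFrom (suc j) p)) m
      ≡⟨ sym (C-⊛-suc (λ j → chainsFrom j p) m) ⟩
    (_C_ ⊛ (λ j → chainsFrom j p)) (suc m) ∎

  upperSum-multichainsFrom m p = begin
    upperSum (multichainsFrom m) p                              ≡⟨ upperSum-cong (multichainsFrom-⊛ m) p ⟩
    upperSum (λ y → (_C_ ⊛ (λ j → chainsFrom j y)) m) p         ≡⟨ upperSum-⊛ _C_ chainsFrom m p ⟩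
    (_C_ ⊛ (λ j → upperSum (chainsFrom j) p)) m                 ≡⟨ ⊛-cong _C_ (λ j → sym (chainsFrom-suc j p)) m ⟩
    (_C_ ⊛ (λ j → chainsFrom (suc j) p)) m                      ∎

  multichainWeightFrom-⊛ : ∀ g m p → multichainWeightFrom g m p ≡ (_C_ ⊛ (λ j → chainWeightFrom g j p)) m
  multichainWeightFrom-⊛ g zero    p = begin
    multichainWeightFrom g 0 p   ≡⟨ Multichains.from-zero (supportWeight g) p ⟩
    supportWeight g (p ∷ [])     ≡⟨ sym (Chains.from-zero (supportWeight g) p) ⟩
    chainWeightFrom g 0 p        ≡⟨ sym (trans (+-identityʳ _) (*-identityˡ _)) ⟩
    (_C_ ⊛ (λ j → chainWeightFrom g j p)) 0 ∎
  multichainWeightFrom-⊛ g (suc m) p = begin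
    multichainWeightFrom g (suc m) p
      ≡⟨ multichainWeightFrom-suc g m p ⟩
    g p * upperSum (multichainsFrom m) p + (multichainWeightFrom g m p + upperSum (multichainWeightFrom g m) p)
      ≡⟨ cong₂ (λ a b → g p * a + b) (upperSum-multichainsFrom m p)
               (cong₂ _+_ (multichainWeightFrom-⊛ g m p)
                          (trans (upperSum-cong (λ y → multichainWeightFrom-⊛ g m y) p) (upperSum-⊛ _C_ (chainWeightFrom g) m p))) ⟩
    g p * Longer + (Weights + Uppers)
      ≡⟨ +-left-comm (g p * Longer) Weights Uppers ⟩
    Weights + (g p * Longer + Uppers)
      ≡⟨ cong (Weights +_) (sym (⊛-chainWeightFrom-suc _C_ g m p)) ⟩
    Weights + (_C_ ⊛ (λ j → chainWeightFrom g (suc j) p)) m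
      ≡⟨ sym (C-⊛-suc (λ j → chainWeightFrom g j p) m) ⟩
    (_C_ ⊛ (λ j → chainWeightFrom g j p)) (suc m) ∎
    where
    Longer Weights Uppers : ℕ
    Longer  = (_C_ ⊛ (λ j → chainsFrom (suc j) p)) m
    Weights = (_C_ ⊛ (λ j → chainWeightFrom g j p)) m
    Uppers  = (_C_ ⊛ (λ j → upperSum (chainWeightFrom g j) p)) m
    +-left-comm : ∀ a b c → a + (b + c) ≡ b + (a + c)
    +-left-comm = solve-∀

  multichainEntryWeightFrom-⊛ : ∀ g m p → multichainEntryWeightFrom g m p ≡ (_C⁺_ ⊛ (λ j → chainWeightFrom g j p)) m
  multichainEntryWeightFrom-⊛ g zero    p = begin
    multichainEntryWeightFrom g 0 p   ≡⟨ Multichains.from-zero (entryWeight g) p ⟩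
    entryWeight g (p ∷ [])            ≡⟨ sym (chain-supportWeight g (p ∷ []) _) ⟩
    supportWeight g (p ∷ [])          ≡⟨ sym (Chains.from-zero (supportWeight g) p) ⟩
    chainWeightFrom g 0 p             ≡⟨ sym (trans (+-identityʳ _) (*-identityˡ _)) ⟩
    (_C⁺_ ⊛ (λ j → chainWeightFrom g j p)) 0 ∎
  multichainEntryWeightFrom-⊛ g (suc m) p = begin
    multichainEntryWeightFrom g (suc m) p
      ≡⟨ multichainEntryWeightFrom-suc g m p ⟩
    g p * multichainsFrom (suc m) p + (multichainEntryWeightFrom g m p + upperSum (multichainEntryWeightFrom g m) p)
      ≡⟨ cong₂ (λ a b → g p * a + b) (trans (multichainsFrom-⊛ (suc m) p) (C-⊛-suc-head (λ j → chainsFrom j p) m))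
               (cong₂ _+_ (multichainEntryWeightFrom-⊛ g m p)
                          (trans (upperSum-cong (λ y → multichainEntryWeightFrom-⊛ g m y) p) (upperSum-⊛ _C⁺_ (chainWeightFrom g) m p))) ⟩
    g p * (1 + Longer) + (Weights + Uppers)
      ≡⟨ regroup (g p) Longer Weights Uppers ⟩
    g p + (g p * Longer + Uppers) + Weights
      ≡⟨ cong₂ (λ a b → a + b + Weights) (sym (chainWeightFrom-zero g p)) (sym (⊛-chainWeightFrom-suc _C⁺_ g m p)) ⟩
    chainWeightFrom g 0 p + (_C⁺_ ⊛ (λ j → chainWeightFrom g (suc j) p)) m + Weights
      ≡⟨ cong (_+ Weights) (sym (C-⊛-suc-head (λ j → chainWeightFrom g j p) m)) ⟩
    (_C_ ⊛ (λ j → chainWeightFrom g j p)) (suc m) + Weights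
      ≡⟨ +-comm _ Weights ⟩
    Weights + (_C_ ⊛ (λ j → chainWeightFrom g j p)) (suc m)
      ≡⟨ sym (C⁺-⊛-suc (λ j → chainWeightFrom g j p) m) ⟩
    (_C⁺_ ⊛ (λ j → chainWeightFrom g j p)) (suc m) ∎
    where
    Longer Weights Uppers : ℕ
    Longer  = (_C⁺_ ⊛ (λ j → chainsFrom (suc j) p)) m
    Weights = (_C⁺_ ⊛ (λ j → chainWeightFrom g j p)) m
    Uppers  = (_C⁺_ ⊛ (λ j → upperSum (chainWeightFrom g j) p)) m
    regroup : ∀ g n w u → g * (1 + n) + (w + u) ≡ g + (g * n + u) + w
    regroup = solve-∀

  chainWeight : (El P → ℕ) → ℕ → ℕ
  chainWeight g k = ∑ (kChains P k) (supportWeight g)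

  multichainWeight : (El P → ℕ) → ℕ → ℕ
  multichainWeight g m = ∑ (mChains P m) (supportWeight g)

  multichainEntryWeight : (El P → ℕ) → ℕ → ℕ
  multichainEntryWeight g m = ∑ (mChains P m) (entryWeight g)

  multichainWeight-⊛ : ∀ g m → multichainWeight g m ≡ (_C_ ⊛ chainWeight g) m
  multichainWeight-⊛ g m = begin
    multichainWeight g m                                          ≡⟨ Multichains.∑-filter≡∑from (supportWeight g) m ⟩
    ∑[ p ∈ elems ] multichainWeightFrom g m p                     ≡⟨ ∑-cong elems (multichainWeightFrom-⊛ g m) ⟩
    ∑[ p ∈ elems ] (_C_ ⊛ (λ j → chainWeightFrom g j p)) m        ≡⟨ ∑-⊛ elems _C_ (chainWeightFrom g) m ⟩
    (_C_ ⊛ (λ j → ∑[ p ∈ elems ] chainWeightFrom g j p)) m        ≡⟨ ⊛-cong _C_ (λ j → sym (Chains.∑-filter≡∑from (supportWeight g) j)) m ⟩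
    (_C_ ⊛ chainWeight g) m                                       ∎

  multichainEntryWeight-⊛ : ∀ g m → multichainEntryWeight g m ≡ (_C⁺_ ⊛ chainWeight g) m
  multichainEntryWeight-⊛ g m = begin
    multichainEntryWeight g m                                     ≡⟨ Multichains.∑-filter≡∑from (entryWeight g) m ⟩
    ∑[ p ∈ elems ] multichainEntryWeightFrom g m p                ≡⟨ ∑-cong elems (multichainEntryWeightFrom-⊛ g m) ⟩
    ∑[ p ∈ elems ] (_C⁺_ ⊛ (λ j → chainWeightFrom g j p)) m       ≡⟨ ∑-⊛ elems _C⁺_ (chainWeightFrom g) m ⟩
    (_C⁺_ ⊛ (λ j → ∑[ p ∈ elems ] chainWeightFrom g j p)) m       ≡⟨ ⊛-cong _C⁺_ (λ j → sym (Chains.∑-filter≡∑from (supportWeight g) j)) m ⟩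
    (_C⁺_ ⊛ chainWeight g) m                                      ∎

  chainWeight-one : ∀ k → chainWeight (λ _ → 1) k ≡ suc k * length (kChains P k)
  chainWeight-one k = trans (∑-filter-cong (isChain? P) (allVecs P (suc k)) size≡length) (∑-const (kChains P k) (suc k))
    where
    size≡length : ∀ c → IsChain P c → supportWeight (λ _ → 1) c ≡ suc k
    size≡length c chain = trans (chain-supportWeight _ c chain) (trans (entryWeight-const 1 c) (*-identityʳ (suc k)))

  multichainEntryWeight-one : ∀ m → multichainEntryWeight (λ _ → 1) m ≡ suc m * length (mChains P m)
  multichainEntryWeight-one m =
    trans (∑-cong (mChains P m) (λ c → trans (entryWeight-const 1 c) (*-identityʳ (suc m)))) (∑-const (mChains P m) (suc m))

  𝔼-chainDist : ∀ f k → 𝔼 P (chainDist P k) f ≡ frac P (chainWeight f k) (chainWeight (λ _ → 1) k)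
  𝔼-chainDist f k = trans (𝔼-frac (λ p → length (filter (p ∈?′_) (kChains P k))) (suc k * length (kChains P k)) f)
    (cong₂ (frac P) (∑-weighted-membership f (kChains P k)) (sym (chainWeight-one k)))

  𝔼-mchainDist : ∀ f m → 𝔼 P (mchainDist P m) f ≡ frac P (multichainWeight f m) (multichainWeight (λ _ → 1) m)
  𝔼-mchainDist f m = trans (𝔼-frac (mcContaining P m) (∑ elems (mcContaining P m)) f)
    (cong₂ (frac P) (∑-weighted-membership f (mChains P m))
                    (trans (∑-cong elems (λ p → sym (*-identityˡ _))) (∑-weighted-membership (λ _ → 1) (mChains P m))))

  𝔼-mchainHatDist : ∀ f m → 𝔼 P (mchainHatDist P m) f ≡ frac P (multichainEntryWeight f m) (multichainEntryWeight (λ _ → 1) m)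
  𝔼-mchainHatDist f m = trans (𝔼-frac (λ p → ∑ (mChains P m) (occurrences P p)) (suc m * length (mChains P m)) f)
    (cong₂ (frac P) (∑-weighted-occurrences f (mChains P m)) (sym (multichainEntryWeight-one m)))

  𝔼-uni : ∀ f → 𝔼 P (uni P) f ≡ frac P (∑ elems f) size
  𝔼-uni f = trans (𝔼-frac (λ _ → 1) size f) (cong (λ n → frac P n size) (∑-cong elems (λ p → *-identityʳ (f p))))

  ∈-allVecs : (c : Vec (El P) k) → c ∈ₗ allVecs P k
  ∈-allVecs []      = Any.here refl
  ∈-allVecs (x ∷ c) = ∈-concatMap⁺ (λ y → map (y ∷_) (allVecs P _)) (Any.map (λ { refl → ∈-map⁺ (x ∷_) (∈-allVecs c) }) (∈-allFin x))

  chainWeight-one-positive : Σ (Vec (El P) (suc k)) (IsChain P) → 0 < chainWeight (λ _ → 1) k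
  chainWeight-one-positive {k} (c , chain) = subst (0 <_) (sym (chainWeight-one k))
    (*-mono-≤ {1} {suc k} (s≤s z≤n) (nonempty (∈-filter⁺ (isChain? P) (∈-allVecs c) chain)))
    where
    nonempty : ∀ {xs : List (Vec (El P) (suc k))} → c ∈ₗ xs → 0 < length xs
    nonempty (Any.here _)  = s≤s z≤n
    nonempty (Any.there _) = s≤s z≤n

  multichainWeight-one-positive : El P → ∀ m → 0 < multichainWeight (λ _ → 1) m
  multichainWeight-one-positive p m = subst (0 <_) (sym (multichainWeight-⊛ _ m))
    (⊛-positive _C_ (chainWeight (λ _ → 1)) m (s≤s z≤n) (chainWeight-one-positive (p ∷ [] , _)))

  multichainEntryWeight-one-positive : El P → ∀ m → 0 < multichainEntryWeight (λ _ → 1) m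
  multichainEntryWeight-one-positive p m = subst (0 <_) (sym (multichainEntryWeight-⊛ _ m))
    (⊛-positive _C⁺_ (chainWeight (λ _ → 1)) m (subst (0 <_) (sym (nC1≡n (suc m))) (s≤s z≤n)) (chainWeight-one-positive (p ∷ [] , _)))

  chainWeight-without-chains : ∀ g k → (∀ (c : Vec (El P) (suc k)) → ¬ IsChain P c) → chainWeight g k ≡ 0
  chainWeight-without-chains g k no-chain =
    cong (λ cs → ∑ cs (supportWeight g)) (filter-none (isChain? P) (All.universal no-chain (allVecs P (suc k))))

  chain-shorten : ∀ {j} → k ≤′ j → Σ (Vec (El P) (suc j)) (IsChain P) → Σ (Vec (El P) (suc k)) (IsChain P)
  chain-shorten ≤′-refl          chain                   = chain
  chain-shorten (≤′-step k≤′j)   (x ∷ y ∷ c , _ , chain) = chain-shorten k≤′j (y ∷ c , chain)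

-- The five conditions

≡-cong-⇔ : ∀ {a} {A : Set a} {x x′ y y′ : A} → x ≡ x′ → y ≡ y′ → (x ≡ y) ⇔ (x′ ≡ y′)
≡-cong-⇔ refl refl = mk⇔ (λ e → e) (λ e → e)

module Conditions (P : FinitePoset) (r : ℕ) (longest : LongestChainLength P r) where
  open FinitePoset P using (size)

  private
    d : El P → ℕ
    d = ddeg P

    D : ℕ
    D = ∑ (elems P) d

    one : El P → ℕ
    one _ = 1

    p₀ : El P
    p₀ = head (proj₁ (proj₁ longest))

    size-positive : 0 < size
    size-positive = ≤-trans (s≤s z≤n) (Fin.toℕ<n p₀)

  ChainCondition MultichainCondition HatMultichainCondition : ℕ → Set
  ChainCondition         k = 𝔼 P (chainDist P k) d ≡ 𝔼 P (uni P) d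
  MultichainCondition    m = 𝔼 P (mchainDist P m) d ≡ 𝔼 P (uni P) d
  HatMultichainCondition m = 𝔼 P (mchainHatDist P m) d ≡ 𝔼 P (uni P) d

  weightedDdeg uniformDdeg : ℕ → ℕ
  weightedDdeg k = chainWeight P d k * size
  uniformDdeg  k = D * chainWeight P one k

  chain-condition⇔ : ∀ k → k ≤ r → ChainCondition k ⇔ (weightedDdeg k ≡ uniformDdeg k)
  chain-condition⇔ k k≤r =
    frac-≡⇔ P _ _ _ _ (chainWeight-one-positive P (chain-shorten P (≤⇒≤′ k≤r) (proj₁ longest))) size-positive
    ⇔-∘ ≡-cong-⇔ (𝔼-chainDist P d k) (𝔼-uni P d)

  multichain-condition⇔ : ∀ m → MultichainCondition m ⇔ ((_C_ ⊛ weightedDdeg) m ≡ (_C_ ⊛ uniformDdeg) m)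
  multichain-condition⇔ m =
    ≡-cong-⇔ (trans (cong (_* size) (multichainWeight-⊛ P d m)) (⊛-distribʳ _C_ size (chainWeight P d) m))
             (trans (cong (D *_) (multichainWeight-⊛ P one m)) (⊛-distribˡ _C_ D (chainWeight P one) m))
    ⇔-∘ (frac-≡⇔ P _ _ _ _ (multichainWeight-one-positive P p₀ m) size-positive
         ⇔-∘ ≡-cong-⇔ (𝔼-mchainDist P d m) (𝔼-uni P d))

  hatMultichain-condition⇔ : ∀ m → HatMultichainCondition m ⇔ ((_C⁺_ ⊛ weightedDdeg) m ≡ (_C⁺_ ⊛ uniformDdeg) m)
  hatMultichain-condition⇔ m =
    ≡-cong-⇔ (trans (cong (_* size) (multichainEntryWeight-⊛ P d m)) (⊛-distribʳ _C⁺_ size (chainWeight P d) m))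
             (trans (cong (D *_) (multichainEntryWeight-⊛ P one m)) (⊛-distribˡ _C⁺_ D (chainWeight P one) m))
    ⇔-∘ (frac-≡⇔ P _ _ _ _ (multichainEntryWeight-one-positive P p₀ m) size-positive
         ⇔-∘ ≡-cong-⇔ (𝔼-mchainHatDist P d m) (𝔼-uni P d))

  agree-above-r : ∀ k → r < k → weightedDdeg k ≡ uniformDdeg k
  agree-above-r k r<k = trans (cong (_* size) (chainWeight-without-chains P d k no-chain))
                              (sym (trans (cong (D *_) (chainWeight-without-chains P one k no-chain)) (*-zeroʳ D)))
    where
    no-chain : ∀ c → ¬ IsChain P c
    no-chain c chain = <⇒≱ r<k (proj₂ longest k c chain)

  multichain-equivalences :
    ((∀ k → k ≤ r → ChainCondition k) ⇔ (∀ m → MultichainCondition m)) ×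
    ((∀ k → k ≤ r → ChainCondition k) ⇔ (∀ m → m ≤ r → MultichainCondition m))
  multichain-equivalences =
    ⊛-unitriangular-conditions _C_ nCn≡1 agree-above-r chain-condition⇔ multichain-condition⇔

  hatMultichain-equivalences :
    ((∀ k → k ≤ r → ChainCondition k) ⇔ (∀ m → HatMultichainCondition m)) ×
    ((∀ k → k ≤ r → ChainCondition k) ⇔ (∀ m → m ≤ r → HatMultichainCondition m))
  hatMultichain-equivalences =
    ⊛-unitriangular-conditions _C⁺_ (λ m → nCn≡1 (suc m)) agree-above-r chain-condition⇔ hatMultichain-condition⇔

proposition1p4 : (P : FinitePoset) (r : ℕ) → LongestChainLength P r →
    let E  = 𝔼 P
        d  = ddeg P
        c1 = ∀ k → k ≤ r → E (chainDist P k) d ≡ E (uni P) d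
        c2 = ∀ m → E (mchainDist P m) d ≡ E (uni P) d
        c3 = ∀ m → m ≤ r → E (mchainDist P m) d ≡ E (uni P) d
        c4 = ∀ m → E (mchainHatDist P m) d ≡ E (uni P) d
        c5 = ∀ m → m ≤ r → E (mchainHatDist P m) d ≡ E (uni P) d
    in (c1 ⇔ c2) × (c1 ⇔ c3) × (c1 ⇔ c4) × (c1 ⇔ c5)
proposition1p4 P r longest = proj₁ multichain-equivalences , proj₂ multichain-equivalences , hatMultichain-equivalences
  where open Conditions P r longest
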